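{- Let $F$ be the face of $P_{\mathrm{utt}}(n)$ consisting of all its points satisfying the equations $$\sum_{j\in V\setminus\{i\}}y_{t,i,j}=1\quad\forall i,t\in V,\ i\ne t,\qquad \sum_{i\in V\setminus\{j\}}y_{t,i,j}=1\quad\forall j,t\in V,\ j\ne t.$$ Then $F=\mathrm{conv}\{(\chi(T),\psi(T)) : T\text{ tournament}\}$. Consequently, the system (F0)–(F7) below together with these equations is an integer programming formulation for this polytope, i.e., the convex hull of its feasible (integral) points equals $\mathrm{conv}\{(\chi(T),\psi(T)) : T\text{ tournament}\}$.
   Context: Let $n\ge4$ be even, $V=\{1,\dots,n\}$ (teams; team $i$ has home venue $i$), $S=\{1,\dots,2n-2\}$ (slots), $A=\{(i,j)\in V\times V:i\ne j\}$, $\mathcal M=\{(k,i,j):k\in S,(i,j)\in A\}$, where $(k,i,j)$ denotes the match between $i$ and $j$ at venue $i$ in slot $k$. Coordinates are $x_{k,i,j}$ ($(k,i,j)\in\mathcal M$) and $y_{t,i,j}$ ($t\in V$, $(i,j)\in A$). The system: (F0) $\sum_{j\in V\setminus\{i\}}(x_{k,i,j}+x_{k,j,i})=1$ for $k\in S$, $k\ge2$, $i\in V$; (F1) $\sum_{k\in S}x_{k,i,j}=1$ for $(i,j)\in A$; (F2) $x_{k,i,t}+x_{k+1,j,t}-1\le y_{t,i,j}$ for $k\in S\setminus\{2n-2\}$, $(i,j)\in A$, $t\in V\setminus\{i,j\}$; (F3) $\sum_{i\in V\setminus\{t\}}x_{k,t,i}+x_{k+1,j,t}-1\le y_{t,t,j}$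 for $k\in S\setminus\{2n-2\}$, $(t,j)\in A$; (F4) $x_{k-1,i,t}+\sum_{j\in V\setminus\{t\}}x_{k,t,j}-1\le y_{t,i,t}$ for $k\in S\setminus\{1\}$, $(i,t)\in A$; (F5) $x_{1,j,t}\le y_{t,t,j}$ for $(t,j)\in A$; (F6) $x_{2n-2,i,t}\le y_{t,i,t}$ for $(i,t)\in A$; (F7) $x\in\{0,1\}^{\mathcal M}$, $y\in\{0,1\}^{V\times A}$. A tournament is a set $T\subseteq\mathcal M$ whose incidence vector $\chi(T)$ satisfies (F0) and (F1). In $T$, team $t$ is at venue $t$ in a slot where it plays at home and at venue $i$ in slot $k$ if $(k,i,t)\in T$; before slot 1 and after slot $2n-2$ it is at venue $t$. Team $t$ travels from venue $i$ to venue $j\ne i$ if it is at $i$ and then at $j$ at consecutive positions of (start, slot $1$, …, slot $2n-2$, end). The travel vector $\psi(T)\in\{0,1\}^{V\times A}$ has $\psi(T)_{t,i,j}=1$ iff team $t$ travels from $i$ to $j$. $P_{\mathrm{utt}}(n)=\mathrm{conv}\{(\chi(T),y)\in\{0,1\}^{\mathcal M}\times\{0,1\}^{V\times A}: T\text{ tournament},\ y\ge\psi(T)\}$; the inequalities $\sum_{j\ne i}y_{t,i,j}\ge1$ and $\sum_{i\ne j}y_{t,i,j}\ge1$ (for $i\ne t$, resp. $j\ne t$) are valid for it.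
   Formalization: The polytope $P_{\mathrm{utt}}(n)$, its face $F$ and the other convex hulls consist of points with rational coordinates, formed as convex combinations with rational coefficients. -}

module Defs where

open import Data.Nat as ℕ using (ℕ; zero; suc; _∸_; _≤_)
open import Data.Nat.Divisibility using (_∣_)
open import Data.Fin using (Fin; toℕ; _≟_)
open import Data.Bool using (Bool; true; false; if_then_else_)
open import Data.Rational as ℚ using (ℚ; 0ℚ; 1ℚ)
open import Data.List using (List; []; _∷_)
open import Data.List.Relation.Unary.All using (All)
open import Data.Product using (Σ; Σ-syntax; _×_; _,_; proj₁; proj₂)
open import Data.Sum using (_⊎_)
open import Relation.Binary.PropositionalEquality using (_≡_; _≢_)
open import Relation.Nullary using (yes; no)
open import Function.Bundles using (_⇔_)

-- Basic notation.  n = number of teams, Team = Fin n (team i ↔ Fin index),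
-- slots 1..2n-2 are represented by Fin (2n-2), slot k ↔ index k-1.

Slots : ℕ → ℕ
Slots n = 2 ℕ.* n ∸ 2

Team : ℕ → Set
Team n = Fin n

Slot : ℕ → Set
Slot n = Fin (Slots n)

sumFin : {m : ℕ} → (Fin m → ℚ) → ℚ
sumFin {zero}  f = 0ℚ
sumFin {suc m} f = f Fin.zero ℚ.+ sumFin {m} (λ i → f (Fin.suc i))
  where import Data.Fin as Fin

sumExcept : {m : ℕ} → Fin m → (Fin m → ℚ) → ℚ
sumExcept i f = sumFin (λ j → if isYes (i ≟ j) then 0ℚ else f j)
  where open import Relation.Nullary.Decidable using (isYes)

b2q : Bool → ℚ
b2q true  = 1ℚ
b2q false = 0ℚ

-- Coordinates are stored on the full grids
-- Slot × V × V and V × V × V; the diagonal entries (i = j) are not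
-- coordinates of the paper's space.  All generating points below have
-- diagonal entries 0, so every point of any convex hull considered here
-- has them equal to 0 (the embedding ℚ^𝓜×ℚ^(V×A) ↪ grid is by zero).

record Point (n : ℕ) : Set where
  constructor pt
  field
    x : Slot n → Team n → Team n → ℚ
    y : Team n → Team n → Team n → ℚ     -- y t i j
open Point public

comb : {n : ℕ} → List (ℚ × Point n) → Point n
comb [] = pt (λ _ _ _ → 0ℚ) (λ _ _ _ → 0ℚ)
comb ((l , p) ∷ L) =
  pt (λ k i j → l ℚ.* x p k i j ℚ.+ x (comb L) k i j)
     (λ t i j → l ℚ.* y p t i j ℚ.+ y (comb L) t i j)

weights : {n : ℕ} → List (ℚ × Point n) → ℚ
weights [] = 0ℚ
weights ((l , _) ∷ L) = l ℚ.+ weights L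

conv : {n : ℕ} → (Point n → Set) → Point n → Set
conv {n} P z = Σ[ L ∈ List (ℚ × Point n) ]
    All (λ lp → (0ℚ ℚ.≤ proj₁ lp) × P (proj₂ lp)) L
  × weights L ≡ 1ℚ
  × (∀ k i j → x z k i j ≡ x (comb L) k i j)
  × (∀ t i j → y z t i j ≡ y (comb L) t i j)

-- 0/1 data: a set T ⊆ Slot×V×V (match (k,i,j): i hosts j in slot k) and
-- a 0/1 y-vector, both as Bool-valued functions.

MatchSet : ℕ → Set
MatchSet n = Slot n → Team n → Team n → Bool

YBits : ℕ → Set
YBits n = Team n → Team n → Team n → Bool

toPoint : {n : ℕ} → MatchSet n → YBits n → Point n
toPoint T Y = pt (λ k i j → b2q (T k i j)) (λ t i j → b2q (Y t i j))

-- (F0): for slots k ≥ 2 (index ≥ 1) and i ∈ V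
F0 : {n : ℕ} → Point n → Set
F0 {n} p = ∀ (k : Slot n) (i : Team n) → 1 ≤ toℕ k →
  sumExcept i (λ j → x p k i j ℚ.+ x p k j i) ≡ 1ℚ

F1 : {n : ℕ} → Point n → Set
F1 {n} p = ∀ (i j : Team n) → i ≢ j → sumFin (λ k → x p k i j) ≡ 1ℚ

F2 : {n : ℕ} → Point n → Set
F2 {n} p = ∀ (k k' : Slot n) → toℕ k' ≡ suc (toℕ k) →
  ∀ (i j t : Team n) → i ≢ j → t ≢ i → t ≢ j →
  (x p k i t ℚ.+ x p k' j t) ℚ.- 1ℚ ℚ.≤ y p t i j

F3 : {n : ℕ} → Point n → Set
F3 {n} p = ∀ (k k' : Slot n) → toℕ k' ≡ suc (toℕ k) →
  ∀ (t j : Team n) → t ≢ j →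
  (sumExcept t (λ i → x p k t i) ℚ.+ x p k' j t) ℚ.- 1ℚ ℚ.≤ y p t t j

F4 : {n : ℕ} → Point n → Set
F4 {n} p = ∀ (km k : Slot n) → toℕ k ≡ suc (toℕ km) →
  ∀ (i t : Team n) → i ≢ t →
  (x p km i t ℚ.+ sumExcept t (λ j → x p k t j)) ℚ.- 1ℚ ℚ.≤ y p t i t

F5 : {n : ℕ} → Point n → Set
F5 {n} p = ∀ (k : Slot n) → toℕ k ≡ 0 →
  ∀ (t j : Team n) → t ≢ j → x p k j t ℚ.≤ y p t t j

F6 : {n : ℕ} → Point n → Set
F6 {n} p = ∀ (k : Slot n) → suc (toℕ k) ≡ Slots n →
  ∀ (i t : Team n) → i ≢ t → x p k i t ℚ.≤ y p t i t

FaceEqs : {n : ℕ} → Point n → Set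
FaceEqs {n} p =
    (∀ (i t : Team n) → i ≢ t → sumExcept i (λ j → y p t i j) ≡ 1ℚ)
  × (∀ (j t : Team n) → j ≢ t → sumExcept j (λ i → y p t i j) ≡ 1ℚ)

NoDiag : {n : ℕ} → MatchSet n → Set
NoDiag {n} T = ∀ (k : Slot n) (i : Team n) → T k i i ≡ false

NoDiagY : {n : ℕ} → YBits n → Set
NoDiagY {n} Y = ∀ (t i : Team n) → Y t i i ≡ false

Tournament : {n : ℕ} → MatchSet n → Set
Tournament {n} T =
  NoDiag T × F0 (toPoint T (λ _ _ _ → false)) × F1 (toPoint T (λ _ _ _ → false))

AtSlot : {n : ℕ} → MatchSet n → Team n → Slot n → Team n → Set
AtSlot {n} T t k v =
    (v ≡ t × Σ[ j ∈ Team n ] T k t j ≡ true)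
  ⊎ (v ≢ t × T k v t ≡ true)

-- Positions 0 (start), 1..2n-2 (slot index + 1), 2n-1 (end).
AtPos : {n : ℕ} → MatchSet n → Team n → ℕ → Team n → Set
AtPos {n} T t p v =
    (p ≡ 0 × v ≡ t)
  ⊎ (p ≡ suc (Slots n) × v ≡ t)
  ⊎ (Σ[ k ∈ Slot n ] p ≡ suc (toℕ k) × AtSlot T t k v)

Travels : {n : ℕ} → MatchSet n → Team n → Team n → Team n → Set
Travels T t i j = i ≢ j × Σ[ p ∈ ℕ ] AtPos T t p i × AtPos T t (suc p) j

IsTravelVector : {n : ℕ} → MatchSet n → YBits n → Set
IsTravelVector {n} T Y = ∀ (t i j : Team n) → (Y t i j ≡ true) ⇔ Travels T t i j

DominatesTravel : {n : ℕ} → MatchSet n → YBits n → Set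
DominatesTravel {n} T Y =
  NoDiagY Y × (∀ (t i j : Team n) → Travels T t i j → Y t i j ≡ true)

UttGen : {n : ℕ} → Point n → Set
UttGen {n} z = Σ[ T ∈ MatchSet n ] Σ[ Y ∈ YBits n ]
  Tournament T × DominatesTravel T Y × z ≡ toPoint T Y

Putt : {n : ℕ} → Point n → Set
Putt = conv UttGen

FaceF : {n : ℕ} → Point n → Set
FaceF z = Putt z × FaceEqs z

TravelGen : {n : ℕ} → Point n → Set
TravelGen {n} z = Σ[ T ∈ MatchSet n ] Σ[ Y ∈ YBits n ]
  Tournament T × IsTravelVector T Y × z ≡ toPoint T Y

IPFeasible : {n : ℕ} → Point n → Set
IPFeasible {n} z = Σ[ X ∈ MatchSet n ] Σ[ Y ∈ YBits n ]
  NoDiag X × NoDiagY Y × z ≡ toPoint X Y ×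
  F0 z × F1 z × F2 z × F3 z × F4 z × F5 z × F6 z × FaceEqs z

Even : ℕ → Set
Even n = 2 ∣ n

{-# OPTIONS --safe #-}
-- Fix a tournament T, a team t and a venue i ≠ t.  Team t visits i in exactly one slot, so the
-- travel vector ψ(T) contains exactly one travel of t out of i and exactly one into i.  Hence on every
-- generator (χ(T), y) of P_utt(n), where y ≥ ψ(T), the left-hand sides of the face equations are at
-- least 1; a convex combination attains 1 only if every generator of positive weight does, and a 0/1
-- vector y ≥ ψ(T) with these row sums is ψ(T) itself.  For the integer programme, (F2)–(F6) linearise
-- "if t is at i in one position and at j in the next, then y t i j = 1", so a 0/1 point satisfies them
-- exactly when y ≥ ψ(T).

module Submission where

open import Defs
open import Algebra.Bundles using (Ring)
open import Data.Bool using (Bool; true; false; if_then_else_)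
open import Data.Empty using (⊥; ⊥-elim)
open import Data.Fin as Fin using (Fin; toℕ; _≟_)
import Data.Fin.Properties as FinP
open import Data.List using (List; []; _∷_)
open import Data.List.Relation.Unary.All as All using (All; []; _∷_)
open import Data.Nat using (ℕ; zero; suc; _+_; _*_; _∸_; _≤_; _<_; z≤n; s≤s)
import Data.Nat.Properties as ℕP
open import Data.Product using (Σ-syntax; ∃-syntax; _×_; _,_; proj₁; proj₂)
import Data.Rational as ℚ
open import Data.Rational using (ℚ; 0ℚ; 1ℚ)
import Data.Rational.Properties as ℚP
open import Data.Sum using (_⊎_; inj₁; inj₂)
open import Data.Unit using (tt)
open import Function using (_∘_)
open import Function.Bundles using (_⇔_; mk⇔; Equivalence)
open import Relation.Binary.Definitions using (tri<; tri≈; tri>)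
open import Relation.Binary.PropositionalEquality
open import Relation.Nullary using (yes; no; ¬_)
open import Relation.Nullary.Decidable using (isYes; True; toWitness; toWitnessFalse)

import Algebra.Properties.Semiring.Sum as SemiringSum
open SemiringSum ℕP.+-*-semiring using (sum; sum-cong-≗; sum-replicate-zero; ∑-distrib-+; ∑-comm)
module ℚΣ = SemiringSum (Ring.semiring ℚP.+-*-ring)

-- Counting with sums of natural numbers

sum-const : {m : ℕ} (c : ℕ) → sum {m} (λ _ → c) ≡ m * c
sum-const {zero}  c = refl
sum-const {suc m} c = cong (c +_) (sum-const {m} c)

sum-mono-≤ : {m : ℕ} {f g : Fin m → ℕ} → (∀ j → f j ≤ g j) → sum f ≤ sum g
sum-mono-≤ {zero}  _   = z≤n
sum-mono-≤ {suc m} f≤g = ℕP.+-mono-≤ (f≤g Fin.zero) (sum-mono-≤ (f≤g ∘ Fin.suc))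

sum-≥-term : {m : ℕ} (f : Fin m → ℕ) (j : Fin m) → f j ≤ sum f
sum-≥-term f Fin.zero    = ℕP.m≤m+n _ _
sum-≥-term f (Fin.suc j) = ℕP.≤-trans (sum-≥-term (f ∘ Fin.suc) j) (ℕP.m≤n+m _ (f Fin.zero))

sum-≥-two-terms : {m : ℕ} (f : Fin m → ℕ) {j j′ : Fin m} → j ≢ j′ → f j + f j′ ≤ sum f
sum-≥-two-terms f {Fin.zero}  {Fin.zero}   j≢j′ = ⊥-elim (j≢j′ refl)
sum-≥-two-terms f {Fin.zero}  {Fin.suc j′} _    = ℕP.+-monoʳ-≤ (f Fin.zero) (sum-≥-term (f ∘ Fin.suc) j′)
sum-≥-two-terms f {Fin.suc j} {Fin.zero}   _    =
  subst (_≤ sum f) (ℕP.+-comm (f Fin.zero) _) (ℕP.+-monoʳ-≤ (f Fin.zero) (sum-≥-term (f ∘ Fin.suc) j))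
sum-≥-two-terms f {Fin.suc j} {Fin.suc j′} j≢j′ =
  ℕP.≤-trans (sum-≥-two-terms (f ∘ Fin.suc) (j≢j′ ∘ cong Fin.suc)) (ℕP.m≤n+m _ (f Fin.zero))

sum-positive⇒term-positive : {m : ℕ} (f : Fin m → ℕ) → 1 ≤ sum f → ∃[ j ] 1 ≤ f j
sum-positive⇒term-positive {suc m} f 1≤∑f with f Fin.zero in f₀≡
... | suc _ = Fin.zero , subst (1 ≤_) (sym f₀≡) (s≤s z≤n)
... | zero  with sum-positive⇒term-positive (f ∘ Fin.suc) 1≤∑f
...   | j , 1≤fj = Fin.suc j , 1≤fj

sum≡1⇒positive-unique : {m : ℕ} (f : Fin m → ℕ) → sum f ≡ 1 →
  {j j′ : Fin m} → 1 ≤ f j → 1 ≤ f j′ → j ≡ j′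
sum≡1⇒positive-unique f ∑f≡1 {j} {j′} 1≤fj 1≤fj′ with j ≟ j′
... | yes j≡j′ = j≡j′
... | no  j≢j′ = ⊥-elim (ℕP.1+n≰n (subst (2 ≤_) ∑f≡1
                   (ℕP.≤-trans (ℕP.+-mono-≤ 1≤fj 1≤fj′) (sum-≥-two-terms f j≢j′))))

sum-supported-at : {m : ℕ} (f : Fin m → ℕ) (i : Fin m) → (∀ j → j ≢ i → f j ≡ 0) → sum f ≡ f i
sum-supported-at {suc m} f Fin.zero    zero-off-i = begin
  f Fin.zero + sum (f ∘ Fin.suc)  ≡⟨ cong (f Fin.zero +_) rest≡0 ⟩
  f Fin.zero + 0                  ≡⟨ ℕP.+-identityʳ _ ⟩
  f Fin.zero                      ∎
  where
    open ≡-Reasoning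
    rest≡0 : sum (f ∘ Fin.suc) ≡ 0
    rest≡0 = trans (sum-cong-≗ (λ j → zero-off-i (Fin.suc j) (λ ()))) (sum-replicate-zero m)
sum-supported-at {suc m} f (Fin.suc i) zero-off-i =
  cong₂ _+_ (zero-off-i Fin.zero (λ ()))
            (sum-supported-at (f ∘ Fin.suc) i (λ j j≢i → zero-off-i (Fin.suc j) (j≢i ∘ FinP.suc-injective)))

-- The ℕ-valued counterpart of the masking in Defs.sumExcept.
except : {m : ℕ} → Fin m → (Fin m → ℕ) → Fin m → ℕ
except i f j = if isYes (i ≟ j) then 0 else f j

except-≢ : {m : ℕ} {i j : Fin m} (f : Fin m → ℕ) → i ≢ j → except i f j ≡ f j
except-≢ {i = i} {j} f i≢j with i ≟ j
... | yes i≡j = ⊥-elim (i≢j i≡j)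
... | no  _   = refl

except-cong : {m : ℕ} (i : Fin m) {f g : Fin m → ℕ} →
  (∀ j → i ≢ j → f j ≡ g j) → ∀ j → except i f j ≡ except i g j
except-cong i f≡g j with i ≟ j
... | yes _   = refl
... | no  i≢j = f≡g j i≢j

except-positive : {m : ℕ} (i : Fin m) (f : Fin m → ℕ) {j : Fin m} →
  1 ≤ except i f j → i ≢ j × 1 ≤ f j
except-positive i f {j} 1≤ with i ≟ j
... | yes _   = ⊥-elim (ℕP.1+n≰n 1≤)
... | no  i≢j = i≢j , 1≤

sum-except-≥-term : {m : ℕ} (i : Fin m) (f : Fin m → ℕ) {j : Fin m} → i ≢ j → f j ≤ sum (except i f)
sum-except-≥-term i f {j} i≢j = subst (_≤ sum (except i f)) (except-≢ f i≢j) (sum-≥-term (except i f) j)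

sum-except≡1⇒positive-unique : {m : ℕ} (i : Fin m) (f : Fin m → ℕ) → sum (except i f) ≡ 1 →
  {j j′ : Fin m} → i ≢ j → i ≢ j′ → 1 ≤ f j → 1 ≤ f j′ → j ≡ j′
sum-except≡1⇒positive-unique i f ∑≡1 i≢j i≢j′ 1≤fj 1≤fj′ = sum≡1⇒positive-unique (except i f) ∑≡1
  (subst (1 ≤_) (sym (except-≢ f i≢j)) 1≤fj) (subst (1 ≤_) (sym (except-≢ f i≢j′)) 1≤fj′)

sum-except-supported-at : {m : ℕ} (i j₀ : Fin m) (f : Fin m → ℕ) → i ≢ j₀ →
  (∀ j → i ≢ j → j ≢ j₀ → f j ≡ 0) → sum (except i f) ≡ f j₀
sum-except-supported-at i j₀ f i≢j₀ zero-off = trans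
  (sum-supported-at (except i f) j₀ zero-off-j₀) (except-≢ f i≢j₀)
  where
    zero-off-j₀ : ∀ j → j ≢ j₀ → except i f j ≡ 0
    zero-off-j₀ j j≢j₀ with i ≟ j
    ... | yes _   = refl
    ... | no  i≢j = zero-off j i≢j j≢j₀

sum≡term+sum-except : {m : ℕ} (i : Fin m) (f : Fin m → ℕ) → sum f ≡ f i + sum (except i f)
sum≡term+sum-except i f = begin
  sum f                                 ≡⟨ sum-cong-≗ split ⟩
  sum (λ j → at-i j + except i f j)     ≡⟨ ∑-distrib-+ at-i (except i f) ⟩
  sum at-i + sum (except i f)           ≡⟨ cong (_+ sum (except i f)) (sum-supported-at at-i i at-i-off) ⟩
  at-i i + sum (except i f)             ≡⟨ cong (_+ sum (except i f)) (at-i-self) ⟩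
  f i + sum (except i f)                ∎
  where
    open ≡-Reasoning
    at-i : Fin _ → ℕ
    at-i j = if isYes (i ≟ j) then f j else 0
    split : ∀ j → f j ≡ at-i j + except i f j
    split j with i ≟ j
    ... | yes _ = sym (ℕP.+-identityʳ (f j))
    ... | no  _ = refl
    at-i-off : ∀ j → j ≢ i → at-i j ≡ 0
    at-i-off j j≢i with i ≟ j
    ... | yes i≡j = ⊥-elim (j≢i (sym i≡j))
    ... | no  _   = refl
    at-i-self : at-i i ≡ f i
    at-i-self with i ≟ i
    ... | yes _   = refl
    ... | no  i≢i = ⊥-elim (i≢i refl)

sum-of-except≡except-of-sum : {m m′ : ℕ} (i : Fin m) (G : Fin m′ → Fin m → ℕ) →
  sum (λ k → sum (except i (G k))) ≡ sum (except i (λ j → sum (λ k → G k j)))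
sum-of-except≡except-of-sum {m′ = m′} i G = trans (∑-comm (λ k j → except i (G k) j)) (sum-cong-≗ pointwise)
  where
    pointwise : ∀ j → sum (λ k → except i (G k) j) ≡ except i (λ j → sum (λ k → G k j)) j
    pointwise j with i ≟ j
    ... | yes _ = sum-replicate-zero m′
    ... | no  _ = refl

except-mono-≤ : {m : ℕ} (i : Fin m) {f g : Fin m → ℕ} → (∀ j → f j ≤ g j) → ∀ j → except i f j ≤ except i g j
except-mono-≤ i f≤g j with isYes (i ≟ j)
... | true  = z≤n
... | false = f≤g j

sum-except-const : {m : ℕ} (i : Fin m) (c : ℕ) → sum (except i (λ _ → c)) ≡ m * c ∸ c
sum-except-const {m} i c = begin
  sum (except i (λ _ → c))              ≡⟨ ℕP.m+n∸m≡n c _ ⟨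
  c + sum (except i (λ _ → c)) ∸ c      ≡⟨ cong (_∸ c) (sum≡term+sum-except i (λ _ → c)) ⟨
  sum {m} (λ _ → c) ∸ c                 ≡⟨ cong (_∸ c) (sum-const {m} c) ⟩
  m * c ∸ c                             ∎
  where open ≡-Reasoning

sum-all-but-first≡1 : {m : ℕ} (H : Fin m → ℕ) (k₀ : Fin m) → toℕ k₀ ≡ 0 →
  (∀ k → 1 ≤ toℕ k → H k ≡ 1) → sum H ≡ H k₀ + (m ∸ 1)
sum-all-but-first≡1 {suc m} H Fin.zero _ rest≡1 =
  cong (H Fin.zero +_) (trans (sum-cong-≗ (λ k → rest≡1 (Fin.suc k) (s≤s z≤n)))
                              (trans (sum-const {m} 1) (ℕP.*-identityʳ m)))

-- Natural numbers and 0/1 values in ℚ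

by-decision : {p q : ℚ} {_ : True (p ℚP.≤? q)} → p ℚ.≤ q
by-decision {_} {_} {p≤q} = toWitness p≤q

fromℕ : ℕ → ℚ
fromℕ zero    = 0ℚ
fromℕ (suc m) = 1ℚ ℚ.+ fromℕ m

fromℕ-+ : (a b : ℕ) → fromℕ (a + b) ≡ fromℕ a ℚ.+ fromℕ b
fromℕ-+ zero    b = sym (ℚP.+-identityˡ (fromℕ b))
fromℕ-+ (suc a) b = trans (cong (1ℚ ℚ.+_) (fromℕ-+ a b)) (sym (ℚP.+-assoc 1ℚ (fromℕ a) (fromℕ b)))

fromℕ-nonNeg : (m : ℕ) → 0ℚ ℚ.≤ fromℕ m
fromℕ-nonNeg zero    = ℚP.≤-refl
fromℕ-nonNeg (suc m) = ℚP.+-mono-≤ (by-decision {0ℚ} {1ℚ}) (fromℕ-nonNeg m)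

fromℕ-mono-≤ : {a b : ℕ} → a ≤ b → fromℕ a ℚ.≤ fromℕ b
fromℕ-mono-≤ {a} a≤b with ℕP.m≤n⇒∃[o]m+o≡n a≤b
... | o , refl = subst (fromℕ a ℚ.≤_) (sym (fromℕ-+ a o))
                   (subst (ℚ._≤ fromℕ a ℚ.+ fromℕ o) (ℚP.+-identityʳ (fromℕ a))
                     (ℚP.+-monoʳ-≤ (fromℕ a) (fromℕ-nonNeg o)))

1ℚ≰0ℚ : ¬ (1ℚ ℚ.≤ 0ℚ)
1ℚ≰0ℚ = toWitnessFalse {a? = 1ℚ ℚP.≤? 0ℚ} tt

+-cancelʳ-≤ : {a b : ℚ} (d : ℚ) → a ℚ.+ d ℚ.≤ b ℚ.+ d → a ℚ.≤ b
+-cancelʳ-≤ d a+d≤b+d = ℚP.≮⇒≥ (λ b<a → ℚP.<-irrefl refl (ℚP.<-≤-trans (ℚP.+-monoˡ-< d b<a) a+d≤b+d))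

fromℕ-suc≰ : (m : ℕ) → ¬ (fromℕ (suc m) ℚ.≤ fromℕ m)
fromℕ-suc≰ m le = 1ℚ≰0ℚ (+-cancelʳ-≤ (fromℕ m) (subst (1ℚ ℚ.+ fromℕ m ℚ.≤_) (sym (ℚP.+-identityˡ _)) le))

fromℕ-<⇒≢ : {a b : ℕ} → a < b → fromℕ a ≢ fromℕ b
fromℕ-<⇒≢ {a} a<b eq = fromℕ-suc≰ a (subst (fromℕ (suc a) ℚ.≤_) (sym eq) (fromℕ-mono-≤ a<b))

fromℕ-injective : {a b : ℕ} → fromℕ a ≡ fromℕ b → a ≡ b
fromℕ-injective {a} {b} eq with ℕP.<-cmp a b
... | tri< a<b _ _ = ⊥-elim (fromℕ-<⇒≢ a<b eq)
... | tri≈ _ a≡b _ = a≡b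
... | tri> _ _ b<a = ⊥-elim (fromℕ-<⇒≢ b<a (sym eq))

𝟙 : Bool → ℕ
𝟙 true  = 1
𝟙 false = 0

b2q≡fromℕ∘𝟙 : (b : Bool) → b2q b ≡ fromℕ (𝟙 b)
b2q≡fromℕ∘𝟙 true  = refl
b2q≡fromℕ∘𝟙 false = refl

𝟙-true : {b : Bool} → b ≡ true → 1 ≤ 𝟙 b
𝟙-true refl = s≤s z≤n

𝟙-positive : (b : Bool) → 1 ≤ 𝟙 b → b ≡ true
𝟙-positive true _ = refl

b2q-≥1 : (b : Bool) → 1ℚ ℚ.≤ b2q b → b ≡ true
b2q-≥1 true  _   = refl
b2q-≥1 false 1≤0 = ⊥-elim (1ℚ≰0ℚ 1≤0)

b2q-nonNeg : (b : Bool) → 0ℚ ℚ.≤ b2q b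
b2q-nonNeg true  = by-decision
b2q-nonNeg false = by-decision

b2q-mono : (a c : Bool) → (a ≡ true → c ≡ true) → b2q a ℚ.≤ b2q c
b2q-mono true  true  _ = ℚP.≤-refl
b2q-mono true  false a⇒c with a⇒c refl
... | ()
b2q-mono false c     _ = b2q-nonNeg c

b2q-mono⁻¹ : {a : Bool} (c : Bool) → a ≡ true → b2q a ℚ.≤ b2q c → c ≡ true
b2q-mono⁻¹ c refl = b2q-≥1 c

-- The linearisation of a ∧ b ⇒ c in (F2)–(F4).
b2q-and : (a b c : Bool) → (a ≡ true → b ≡ true → c ≡ true) → (b2q a ℚ.+ b2q b) ℚ.- 1ℚ ℚ.≤ b2q c
b2q-and true  true  true  _ = by-decision
b2q-and true  true  false ab⇒c with ab⇒c refl refl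
... | ()
b2q-and true  false true  _ = by-decision
b2q-and true  false false _ = by-decision
b2q-and false true  true  _ = by-decision
b2q-and false true  false _ = by-decision
b2q-and false false true  _ = by-decision
b2q-and false false false _ = by-decision

b2q-and⁻¹ : {a b : Bool} (c : Bool) → a ≡ true → b ≡ true → (b2q a ℚ.+ b2q b) ℚ.- 1ℚ ℚ.≤ b2q c → c ≡ true
b2q-and⁻¹ c refl refl le = b2q-≥1 c (ℚP.≤-trans by-decision le)

-- Sums of rationals

sumFin≡sum : {m : ℕ} (f : Fin m → ℚ) → sumFin f ≡ ℚΣ.sum f
sumFin≡sum {zero}  f = refl
sumFin≡sum {suc m} f = cong (f Fin.zero ℚ.+_) (sumFin≡sum (f ∘ Fin.suc))

sumFin-cong : {m : ℕ} {f g : Fin m → ℚ} → (∀ j → f j ≡ g j) → sumFin f ≡ sumFin g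
sumFin-cong {f = f} {g} f≗g = trans (sumFin≡sum f) (trans (ℚΣ.sum-cong-≗ f≗g) (sym (sumFin≡sum g)))

sumExcept-cong : {m : ℕ} (i : Fin m) {f g : Fin m → ℚ} → (∀ j → f j ≡ g j) → sumExcept i f ≡ sumExcept i g
sumExcept-cong i f≗g = sumFin-cong (λ j → cong (if isYes (i ≟ j) then 0ℚ else_) (f≗g j))

sumFin-linear : {m : ℕ} (a : ℚ) (f g : Fin m → ℚ) →
  sumFin (λ j → a ℚ.* f j ℚ.+ g j) ≡ a ℚ.* sumFin f ℚ.+ sumFin g
sumFin-linear {m} a f g = begin
  sumFin {m} (λ j → a ℚ.* f j ℚ.+ g j)        ≡⟨ sumFin≡sum {m} _ ⟩
  ℚΣ.sum {m} (λ j → a ℚ.* f j ℚ.+ g j)        ≡⟨ ℚΣ.∑-distrib-+ (λ j → a ℚ.* f j) g ⟩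
  ℚΣ.sum (λ j → a ℚ.* f j) ℚ.+ ℚΣ.sum g       ≡⟨ cong (ℚ._+ ℚΣ.sum g) (ℚΣ.*-distribˡ-sum a f) ⟨
  a ℚ.* ℚΣ.sum f ℚ.+ ℚΣ.sum g                 ≡⟨ cong₂ (λ u v → a ℚ.* u ℚ.+ v) (sumFin≡sum f) (sumFin≡sum g) ⟨
  a ℚ.* sumFin f ℚ.+ sumFin g                 ∎
  where open ≡-Reasoning

sumExcept-linear : {m : ℕ} (i : Fin m) (a : ℚ) (f g : Fin m → ℚ) →
  sumExcept i (λ j → a ℚ.* f j ℚ.+ g j) ≡ a ℚ.* sumExcept i f ℚ.+ sumExcept i g
sumExcept-linear {m} i a f g = trans (sumFin-cong masked) (sumFin-linear {m} a _ _)
  where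
    masked : ∀ (j : Fin m) → (if isYes (i ≟ j) then 0ℚ else a ℚ.* f j ℚ.+ g j)
                 ≡ a ℚ.* (if isYes (i ≟ j) then 0ℚ else f j) ℚ.+ (if isYes (i ≟ j) then 0ℚ else g j)
    masked j with isYes (i ≟ j)
    ... | true  = sym (trans (ℚP.+-identityʳ _) (ℚP.*-zeroʳ a))
    ... | false = refl

sumExcept-zero : {m : ℕ} (i : Fin m) → sumExcept i (λ _ → 0ℚ) ≡ 0ℚ
sumExcept-zero {m} i = trans (sumFin-cong masked) (trans (sumFin≡sum {m} _) (ℚΣ.sum-replicate-zero m))
  where
    masked : ∀ (j : Fin m) → (if isYes (i ≟ j) then 0ℚ else 0ℚ) ≡ 0ℚ
    masked j with isYes (i ≟ j)
    ... | true  = refl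
    ... | false = refl

sumFin-fromℕ : {m : ℕ} (f : Fin m → ℕ) → sumFin (λ j → fromℕ (f j)) ≡ fromℕ (sum f)
sumFin-fromℕ {zero}  f = refl
sumFin-fromℕ {suc m} f = trans (cong (fromℕ (f Fin.zero) ℚ.+_) (sumFin-fromℕ (f ∘ Fin.suc)))
                               (sym (fromℕ-+ (f Fin.zero) _))

sumExcept-fromℕ : {m : ℕ} (i : Fin m) (f : Fin m → ℕ) →
  sumExcept i (λ j → fromℕ (f j)) ≡ fromℕ (sum (except i f))
sumExcept-fromℕ i f = trans (sumFin-cong masked) (sumFin-fromℕ (except i f))
  where
    masked : ∀ j → (if isYes (i ≟ j) then 0ℚ else fromℕ (f j)) ≡ fromℕ (except i f j)
    masked j with isYes (i ≟ j)
    ... | true  = refl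
    ... | false = refl

sumFin-b2q : {m : ℕ} (g : Fin m → Bool) → sumFin (λ j → b2q (g j)) ≡ fromℕ (sum (𝟙 ∘ g))
sumFin-b2q g = trans (sumFin-cong (b2q≡fromℕ∘𝟙 ∘ g)) (sumFin-fromℕ (𝟙 ∘ g))

sumExcept-b2q : {m : ℕ} (i : Fin m) (g : Fin m → Bool) →
  sumExcept i (λ j → b2q (g j)) ≡ fromℕ (sum (except i (𝟙 ∘ g)))
sumExcept-b2q i g = trans (sumExcept-cong i (b2q≡fromℕ∘𝟙 ∘ g)) (sumExcept-fromℕ i (𝟙 ∘ g))

sumExcept-b2q≡1 : {m : ℕ} (i : Fin m) (f : Fin m → Bool) {j₀ : Fin m} → i ≢ j₀ → f j₀ ≡ true →
  (∀ j → i ≢ j → f j ≡ true → j ≡ j₀) → sumExcept i (λ j → b2q (f j)) ≡ 1ℚ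
sumExcept-b2q≡1 i f {j₀} i≢j₀ fj₀ only-j₀ = trans (sumExcept-b2q i f)
  (cong fromℕ (trans (sum-except-supported-at i j₀ (𝟙 ∘ f) i≢j₀ zero-off) (cong 𝟙 fj₀)))
  where
    zero-off : ∀ j → i ≢ j → j ≢ j₀ → 𝟙 (f j) ≡ 0
    zero-off j i≢j j≢j₀ with f j in fj
    ... | false = refl
    ... | true  = ⊥-elim (j≢j₀ (only-j₀ j i≢j fj))

sumExcept-b2q≥1 : {m : ℕ} (i : Fin m) (f : Fin m → Bool) {j : Fin m} → i ≢ j → f j ≡ true →
  1ℚ ℚ.≤ sumExcept i (λ j → b2q (f j))
sumExcept-b2q≥1 i f i≢j fj = subst (1ℚ ℚ.≤_) (sym (sumExcept-b2q i f))
  (fromℕ-mono-≤ (ℕP.≤-trans (𝟙-true fj) (sum-except-≥-term i (𝟙 ∘ f) i≢j)))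

sumExcept-b2q≡1⇒unique : {m : ℕ} (i : Fin m) (f : Fin m → Bool) → sumExcept i (λ j → b2q (f j)) ≡ 1ℚ →
  {j j′ : Fin m} → i ≢ j → i ≢ j′ → f j ≡ true → f j′ ≡ true → j ≡ j′
sumExcept-b2q≡1⇒unique i f sum≡1 i≢j i≢j′ fj fj′ = sum-except≡1⇒positive-unique i (𝟙 ∘ f)
  (fromℕ-injective (trans (sym (sumExcept-b2q i f)) sum≡1)) i≢j i≢j′ (𝟙-true fj) (𝟙-true fj′)

-- Convex combinations

weightedSum : {n : ℕ} → List (ℚ × Point n) → (Point n → ℚ) → ℚ
weightedSum []            s = 0ℚ
weightedSum ((l , p) ∷ L) s = l ℚ.* s p ℚ.+ weightedSum L s

sumExcept-comb : {n : ℕ} (i : Fin n) (G : Point n → Fin n → ℚ) →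
  (∀ l p L j → G (comb ((l , p) ∷ L)) j ≡ l ℚ.* G p j ℚ.+ G (comb L) j) →
  (∀ j → G (comb []) j ≡ 0ℚ) →
  (L : List (ℚ × Point n)) → sumExcept i (G (comb L)) ≡ weightedSum L (λ p → sumExcept i (G p))
sumExcept-comb i G G-∷ G-[] [] = trans (sumExcept-cong i G-[]) (sumExcept-zero i)
sumExcept-comb i G G-∷ G-[] ((l , p) ∷ L) = begin
  sumExcept i (G (comb ((l , p) ∷ L)))                     ≡⟨ sumExcept-cong i (G-∷ l p L) ⟩
  sumExcept i (λ j → l ℚ.* G p j ℚ.+ G (comb L) j)         ≡⟨ sumExcept-linear i l (G p) (G (comb L)) ⟩
  l ℚ.* sumExcept i (G p) ℚ.+ sumExcept i (G (comb L))
    ≡⟨ cong (l ℚ.* sumExcept i (G p) ℚ.+_) (sumExcept-comb i G G-∷ G-[] L) ⟩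
  weightedSum ((l , p) ∷ L) (λ q → sumExcept i (G q))      ∎
  where open ≡-Reasoning

outSum : {n : ℕ} → Team n → Team n → Point n → ℚ
outSum t i p = sumExcept i (λ j → y p t i j)

inSum : {n : ℕ} → Team n → Team n → Point n → ℚ
inSum t j p = sumExcept j (λ i → y p t i j)

outSum-comb : {n : ℕ} (t i : Team n) (L : List (ℚ × Point n)) → outSum t i (comb L) ≡ weightedSum L (outSum t i)
outSum-comb t i = sumExcept-comb i (λ p j → y p t i j) (λ _ _ _ _ → refl) (λ _ → refl)

inSum-comb : {n : ℕ} (t j : Team n) (L : List (ℚ × Point n)) → inSum t j (comb L) ≡ weightedSum L (inSum t j)
inSum-comb t j = sumExcept-comb j (λ p i → y p t i j) (λ _ _ _ _ → refl) (λ _ → refl)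

≤-*-≥1 : (l s : ℚ) → 0ℚ ℚ.≤ l → 1ℚ ℚ.≤ s → l ℚ.≤ l ℚ.* s
≤-*-≥1 l s 0≤l 1≤s = subst (ℚ._≤ l ℚ.* s) (ℚP.*-identityʳ l) (ℚP.*-monoˡ-≤-nonNeg l {{ℚ.nonNegative 0≤l}} 1≤s)

*-≡-self⇒≡1 : (l s : ℚ) → 0ℚ ℚ.≤ l → l ≢ 0ℚ → 1ℚ ℚ.≤ s → l ℚ.* s ≡ l → s ≡ 1ℚ
*-≡-self⇒≡1 l s 0≤l l≢0 1≤s ls≡l = ℚP.≤-antisym s≤1 1≤s
  where
    instance
      _ : ℚ.Positive l
      _ = ℚP.nonNeg∧nonZero⇒pos l {{ℚ.nonNegative 0≤l}} {{ℚ.≢-nonZero l≢0}}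
    s≤1 : s ℚ.≤ 1ℚ
    s≤1 = ℚP.*-cancelˡ-≤-pos l (ℚP.≤-reflexive (trans ls≡l (sym (ℚP.*-identityʳ l))))

+-≡-+⇒≡ : {a b c d : ℚ} → b ℚ.≤ a → d ℚ.≤ c → a ℚ.+ c ≡ b ℚ.+ d → a ≡ b × c ≡ d
+-≡-+⇒≡ {a} {b} {c} {d} b≤a d≤c eq =
    ℚP.≤-antisym (+-cancelʳ-≤ d (ℚP.≤-trans (ℚP.+-monoʳ-≤ a d≤c) (ℚP.≤-reflexive eq))) b≤a
  , ℚP.≤-antisym (+-cancelʳ-≤ b (ℚP.≤-trans (ℚP.+-monoʳ-≤ c b≤a)
                   (ℚP.≤-reflexive (trans (ℚP.+-comm c a) (trans eq (ℚP.+-comm b d)))))) d≤c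

weights≤weightedSum : {n : ℕ} (L : List (ℚ × Point n)) (s : Point n → ℚ) →
  All (λ lp → 0ℚ ℚ.≤ proj₁ lp) L → All (λ lp → 1ℚ ℚ.≤ s (proj₂ lp)) L → weights L ℚ.≤ weightedSum L s
weights≤weightedSum []            s []            []              = ℚP.≤-refl
weights≤weightedSum ((l , p) ∷ L) s (0≤l ∷ 0≤ls) (1≤sp ∷ 1≤sps) =
  ℚP.+-mono-≤ (≤-*-≥1 l (s p) 0≤l 1≤sp) (weights≤weightedSum L s 0≤ls 1≤sps)

weightedSum≡weights⇒tight : {n : ℕ} (L : List (ℚ × Point n)) (s : Point n → ℚ) →
  All (λ lp → 0ℚ ℚ.≤ proj₁ lp) L → All (λ lp → 1ℚ ℚ.≤ s (proj₂ lp)) L → weightedSum L s ≡ weights L →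
  All (λ lp → proj₁ lp ≢ 0ℚ → s (proj₂ lp) ≡ 1ℚ) L
weightedSum≡weights⇒tight []            s []            []              _  = []
weightedSum≡weights⇒tight ((l , p) ∷ L) s (0≤l ∷ 0≤ls) (1≤sp ∷ 1≤sps) eq =
    (λ l≢0 → *-≡-self⇒≡1 l (s p) 0≤l l≢0 1≤sp (proj₁ split))
  ∷ weightedSum≡weights⇒tight L s 0≤ls 1≤sps (proj₂ split)
  where
    split : l ℚ.* s p ≡ l × weightedSum L s ≡ weights L
    split = +-≡-+⇒≡ (≤-*-≥1 l (s p) 0≤l 1≤sp) (weights≤weightedSum L s 0≤ls 1≤sps) eq

weightedSum-of-1 : {n : ℕ} (L : List (ℚ × Point n)) (s : Point n → ℚ) →
  All (λ lp → s (proj₂ lp) ≡ 1ℚ) L → weightedSum L s ≡ weights L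
weightedSum-of-1 []            s []            = refl
weightedSum-of-1 ((l , p) ∷ L) s (sp≡1 ∷ sps≡1) =
  cong₂ ℚ._+_ (trans (cong (l ℚ.*_) sp≡1) (ℚP.*-identityʳ l)) (weightedSum-of-1 L s sps≡1)

_≈ₚ_ : {n : ℕ} → Point n → Point n → Set
p ≈ₚ q = (∀ k i j → x p k i j ≡ x q k i j) × (∀ t i j → y p t i j ≡ y q t i j)

conv-resp-≈ₚ : {n : ℕ} {P : Point n → Set} {p q : Point n} → p ≈ₚ q → conv P q → conv P p
conv-resp-≈ₚ (p≈x , p≈y) (L , gens , w , q≈x , q≈y) =
  L , gens , w , (λ k i j → trans (p≈x k i j) (q≈x k i j)) , (λ t i j → trans (p≈y t i j) (q≈y t i j))

conv-mono : {n : ℕ} {P Q : Point n → Set} → (∀ p → P p → Q p) → ∀ z → conv P z → conv Q z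
conv-mono P⊆Q z (L , gens , w , eqx , eqy) = L , All.map (λ (0≤l , Pp) → 0≤l , P⊆Q _ Pp) gens , w , eqx , eqy

drop-null-weights : {n : ℕ} {Q : Point n → Set} (L : List (ℚ × Point n)) →
  All (λ lp → 0ℚ ℚ.≤ proj₁ lp × (proj₁ lp ≢ 0ℚ → Q (proj₂ lp))) L →
  Σ[ L′ ∈ List (ℚ × Point n) ] All (λ lp → 0ℚ ℚ.≤ proj₁ lp × Q (proj₂ lp)) L′
    × weights L′ ≡ weights L × comb L′ ≈ₚ comb L
drop-null-weights [] [] = [] , [] , refl , (λ _ _ _ → refl) , (λ _ _ _ → refl)
drop-null-weights ((l , p) ∷ L) ((0≤l , Q-if-l≢0) ∷ gens)
  with drop-null-weights L gens | l ℚP.≟ 0ℚ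
... | L′ , gens′ , w′ , eqx , eqy | yes refl =
  L′ , gens′ , trans w′ (sym (ℚP.+-identityˡ (weights L))) ,
  (λ k i j → trans (eqx k i j) (sym (null (x p k i j) _))) , (λ t i j → trans (eqy t i j) (sym (null (y p t i j) _)))
  where
    null : (a b : ℚ) → 0ℚ ℚ.* a ℚ.+ b ≡ b
    null a b = trans (cong (ℚ._+ b) (ℚP.*-zeroˡ a)) (ℚP.+-identityˡ b)
... | L′ , gens′ , w′ , eqx , eqy | no l≢0 =
  (l , p) ∷ L′ , (0≤l , Q-if-l≢0 l≢0) ∷ gens′ , cong (l ℚ.+_) w′ ,
  (λ k i j → cong (l ℚ.* x p k i j ℚ.+_) (eqx k i j)) , (λ t i j → cong (l ℚ.* y p t i j ℚ.+_) (eqy t i j))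

conv-of-support : {n : ℕ} {Q : Point n → Set} (L : List (ℚ × Point n)) →
  All (λ lp → 0ℚ ℚ.≤ proj₁ lp × (proj₁ lp ≢ 0ℚ → Q (proj₂ lp))) L → weights L ≡ 1ℚ → conv Q (comb L)
conv-of-support L gens w with drop-null-weights L gens
... | L′ , gens′ , w′ , eqx , eqy =
  L′ , gens′ , trans w′ w , (λ k i j → sym (eqx k i j)) , (λ t i j → sym (eqy t i j))

-- Tournaments

predecessor-or-first : {m : ℕ} (k : Fin m) → toℕ k ≡ 0 ⊎ Σ[ k⁻ ∈ Fin m ] toℕ k ≡ suc (toℕ k⁻)
predecessor-or-first Fin.zero    = inj₁ refl
predecessor-or-first (Fin.suc k) = inj₂ (Fin.inject₁ k , cong suc (sym (FinP.toℕ-inject₁ k)))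

successor-or-last : {m : ℕ} (k : Fin m) → (Σ[ k⁺ ∈ Fin m ] toℕ k⁺ ≡ suc (toℕ k)) ⊎ suc (toℕ k) ≡ m
successor-or-last {m} k with suc (toℕ k) ℕP.≟ m
... | yes k+1≡m = inj₂ k+1≡m
... | no  k+1≢m = inj₁ (Fin.fromℕ< k+1<m , FinP.toℕ-fromℕ< k+1<m)
  where
    k+1<m : suc (toℕ k) < m
    k+1<m = ℕP.≤∧≢⇒< (FinP.toℕ<n k) k+1≢m

games : {n : ℕ} → MatchSet n → Slot n → Team n → Team n → ℕ
games T k t j = 𝟙 (T k t j) + 𝟙 (T k j t)

PlaysEverySlot : {n : ℕ} → MatchSet n → Set
PlaysEverySlot {n} T = ∀ (k : Slot n) (t : Team n) → sum (except t (games T k t)) ≡ 1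

EachMatchOnce : {n : ℕ} → MatchSet n → Set
EachMatchOnce {n} T = ∀ (i j : Team n) → i ≢ j → sum (λ k → 𝟙 (T k i j)) ≡ 1

h+[S∸1]≡S⇒h≡1 : {h S : ℕ} → 0 < S → h + (S ∸ 1) ≡ S → h ≡ 1
h+[S∸1]≡S⇒h≡1 {h} {suc S} _ eq = ℕP.+-cancelʳ-≡ S h 1 eq

-- (F0) is not imposed on slot 1; it follows by counting all games of a team.
tournament-structure : {n : ℕ} (T : MatchSet n) → Tournament T → PlaysEverySlot T × EachMatchOnce T
tournament-structure {n} T (_ , F0T , F1T) = plays , once
  where
    once : EachMatchOnce T
    once i j i≢j = fromℕ-injective (trans (sym (sumFin-b2q (λ k → T k i j))) (F1T i j i≢j))

    plays-later : ∀ k t → 1 ≤ toℕ k → sum (except t (games T k t)) ≡ 1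
    plays-later k t 1≤k = fromℕ-injective (begin
      fromℕ (sum (except t (games T k t)))                 ≡⟨ sumExcept-fromℕ t (games T k t) ⟨
      sumExcept t (λ j → fromℕ (games T k t j))            ≡⟨ sumExcept-cong t (λ j → fromℕ-+ (𝟙 (T k t j)) _) ⟩
      sumExcept t (λ j → fromℕ (𝟙 (T k t j)) ℚ.+ fromℕ (𝟙 (T k j t)))
        ≡⟨ sumExcept-cong t (λ j → sym (cong₂ ℚ._+_ (b2q≡fromℕ∘𝟙 (T k t j)) (b2q≡fromℕ∘𝟙 (T k j t)))) ⟩
      sumExcept t (λ j → b2q (T k t j) ℚ.+ b2q (T k j t))  ≡⟨ F0T k t 1≤k ⟩
      1ℚ                                                   ∎)
      where open ≡-Reasoning

    games-total : ∀ t → sum (λ k → sum (except t (games T k t))) ≡ Slots n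
    games-total t = begin
      sum (λ k → sum (except t (games T k t)))                  ≡⟨ sum-of-except≡except-of-sum t (λ k → games T k t) ⟩
      sum (except t (λ j → sum (λ k → games T k t j)))          ≡⟨ sum-cong-≗ (except-cong t two-matches) ⟩
      sum (except t (λ _ → 2))                                  ≡⟨ sum-except-const t 2 ⟩
      n * 2 ∸ 2                                                 ≡⟨ cong (_∸ 2) (ℕP.*-comm n 2) ⟩
      Slots n                                                   ∎
      where
        open ≡-Reasoning
        two-matches : ∀ j → t ≢ j → sum (λ k → games T k t j) ≡ 2
        two-matches j t≢j = trans (∑-distrib-+ (λ k → 𝟙 (T k t j)) (λ k → 𝟙 (T k j t)))
                                  (cong₂ _+_ (once t j t≢j) (once j t (t≢j ∘ sym)))

    plays : PlaysEverySlot T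
    plays k t with predecessor-or-first k
    ... | inj₂ (_ , k≡) = plays-later k t (subst (1 ≤_) (sym k≡) (s≤s z≤n))
    ... | inj₁ k≡0      = h+[S∸1]≡S⇒h≡1 (ℕP.≤-<-trans z≤n (FinP.toℕ<n k))
      (trans (sym (sum-all-but-first≡1 (λ k → sum (except t (games T k t))) k k≡0 (λ k′ → plays-later k′ t)))
             (games-total t))

slot≢end : {n : ℕ} (k : Slot n) → suc (toℕ k) ≢ suc (Slots n)
slot≢end k e = ℕP.<-irrefl (ℕP.suc-injective e) (FinP.toℕ<n k)

module Itinerary {n : ℕ} (T : MatchSet n) where

  at-home : {k : Slot n} {t j : Team n} → T k t j ≡ true → AtSlot T t k t
  at-home {j = j} h = inj₁ (refl , j , h)

  at-away : {k : Slot n} {t i : Team n} → i ≢ t → T k i t ≡ true → AtSlot T t k i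
  at-away i≢t h = inj₂ (i≢t , h)

  away-match : {k : Slot n} {t i : Team n} → AtSlot T t k i → i ≢ t → T k i t ≡ true
  away-match (inj₁ (refl , _)) i≢t = ⊥-elim (i≢t refl)
  away-match (inj₂ (_ , h))    _   = h

  away-position : {p : ℕ} {t i : Team n} → AtPos T t p i → i ≢ t →
    Σ[ k ∈ Slot n ] p ≡ suc (toℕ k) × T k i t ≡ true
  away-position (inj₁ (_ , refl))           i≢t = ⊥-elim (i≢t refl)
  away-position (inj₂ (inj₁ (_ , refl)))    i≢t = ⊥-elim (i≢t refl)
  away-position (inj₂ (inj₂ (k , p≡ , at))) i≢t = k , p≡ , away-match at i≢t

  first-travel : {k : Slot n} {t j : Team n} →
    toℕ k ≡ 0 → AtSlot T t k j → t ≢ j → Travels T t t j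
  first-travel {k = k} k≡0 at t≢j = t≢j , 0 , inj₁ (refl , refl) , inj₂ (inj₂ (k , cong suc (sym k≡0) , at))

  last-travel : {k : Slot n} {t i : Team n} →
    suc (toℕ k) ≡ Slots n → AtSlot T t k i → i ≢ t → Travels T t i t
  last-travel {k = k} k+1≡S at i≢t =
    i≢t , suc (toℕ k) , inj₂ (inj₂ (k , refl , at)) , inj₂ (inj₁ (cong suc k+1≡S , refl))

  step-travel : {k k′ : Slot n} {t i j : Team n} →
    toℕ k′ ≡ suc (toℕ k) → AtSlot T t k i → AtSlot T t k′ j → i ≢ j → Travels T t i j
  step-travel {k = k} {k′} k′≡k+1 at at′ i≢j =
    i≢j , suc (toℕ k) , inj₂ (inj₂ (k , refl , at)) , inj₂ (inj₂ (k′ , cong suc (sym k′≡k+1) , at′))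

  travel-cases : {t i j : Team n} → Travels T t i j →
      (i ≡ t × Σ[ k ∈ Slot n ] toℕ k ≡ 0 × AtSlot T t k j)
    ⊎ (j ≡ t × Σ[ k ∈ Slot n ] suc (toℕ k) ≡ Slots n × AtSlot T t k i)
    ⊎ (Σ[ k ∈ Slot n ] Σ[ k′ ∈ Slot n ] toℕ k′ ≡ suc (toℕ k) × AtSlot T t k i × AtSlot T t k′ j)
  travel-cases (i≢j , _ , inj₁ (refl , refl) , inj₂ (inj₁ (_ , refl)))            = ⊥-elim (i≢j refl)
  travel-cases (_   , _ , inj₁ (refl , refl) , inj₂ (inj₂ (k , 1≡k+1 , at)))       =
    inj₁ (refl , k , ℕP.suc-injective (sym 1≡k+1) , at)
  travel-cases (_   , _ , inj₂ (inj₁ (refl , _)) , inj₂ (inj₁ (S+2≡S+1 , _)))      =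
    ⊥-elim (ℕP.1+n≢n (ℕP.suc-injective S+2≡S+1))
  travel-cases (_   , _ , inj₂ (inj₁ (refl , _)) , inj₂ (inj₂ (k , S+2≡k+1 , _)))  =
    ⊥-elim (ℕP.<-irrefl refl (ℕP.<-trans (FinP.toℕ<n k) (ℕP.≤-reflexive (ℕP.suc-injective S+2≡k+1))))
  travel-cases (_   , _ , inj₂ (inj₂ (k , refl , at)) , inj₂ (inj₁ (k+2≡S+1 , refl))) =
    inj₂ (inj₁ (refl , k , ℕP.suc-injective k+2≡S+1 , at))
  travel-cases (_   , _ , inj₂ (inj₂ (k , refl , at)) , inj₂ (inj₂ (k′ , k+2≡k′+1 , at′))) =
    inj₂ (inj₂ (k , k′ , sym (ℕP.suc-injective k+2≡k′+1) , at , at′))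

travel-vector-noDiag : {n : ℕ} {T : MatchSet n} {Y : YBits n} → IsTravelVector T Y → NoDiagY Y
travel-vector-noDiag {Y = Y} ψ t i with Y t i i in Ytii
... | false = refl
... | true  = ⊥-elim (proj₁ (Equivalence.to (ψ t i i) Ytii) refl)

module Schedule {n : ℕ} (T : MatchSet n) (noDiag : NoDiag T)
                (plays : PlaysEverySlot T) (once : EachMatchOnce T) where

  open Itinerary T

  host≢guest : {k : Slot n} {t j : Team n} → T k t j ≡ true → t ≢ j
  host≢guest {k} {t} h refl with trans (sym h) (noDiag k t)
  ... | ()

  match-exists : {i t : Team n} → i ≢ t → Σ[ k ∈ Slot n ] T k i t ≡ true
  match-exists {i} {t} i≢t with sum-positive⇒term-positive (λ k → 𝟙 (T k i t)) (ℕP.≤-reflexive (sym (once i t i≢t)))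
  ... | k , 1≤ = k , 𝟙-positive _ 1≤

  match-slot-unique : {k k′ : Slot n} {i t : Team n} → T k i t ≡ true → T k′ i t ≡ true → k ≡ k′
  match-slot-unique {i = i} {t} h h′ =
    sum≡1⇒positive-unique (λ k → 𝟙 (T k i t)) (once i t (host≢guest h)) (𝟙-true h) (𝟙-true h′)

  games-host : {k : Slot n} {t j : Team n} → T k t j ≡ true → 1 ≤ games T k t j
  games-host h = ℕP.≤-trans (𝟙-true h) (ℕP.m≤m+n _ _)

  games-guest : {k : Slot n} {t j : Team n} → T k j t ≡ true → 1 ≤ games T k t j
  games-guest h = ℕP.≤-trans (𝟙-true h) (ℕP.m≤n+m _ _)

  opponent-unique : {k : Slot n} {t j j′ : Team n} → t ≢ j → t ≢ j′ →
    1 ≤ games T k t j → 1 ≤ games T k t j′ → j ≡ j′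
  opponent-unique {k} {t} = sum-except≡1⇒positive-unique t (games T k t) (plays k t)

  ¬host-and-guest : {k : Slot n} {t j : Team n} → T k t j ≡ true → T k j t ≡ true → ⊥
  ¬host-and-guest {k} {t} {j} h h′ = ℕP.1+n≰n (begin
    2                                ≤⟨ ℕP.+-mono-≤ (𝟙-true h) (𝟙-true h′) ⟩
    games T k t j                    ≤⟨ sum-except-≥-term t (games T k t) (host≢guest h) ⟩
    sum (except t (games T k t))     ≡⟨ plays k t ⟩
    1                                ∎)
    where open ℕP.≤-Reasoning

  venue-exists : (k : Slot n) (t : Team n) → Σ[ v ∈ Team n ] AtSlot T t k v
  venue-exists k t with sum-positive⇒term-positive (except t (games T k t)) (ℕP.≤-reflexive (sym (plays k t)))
  ... | j , 1≤ with except-positive t (games T k t) 1≤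
  ... | t≢j , 1≤games with T k t j in home | T k j t in away
  ...   | true  | _     = t , at-home home
  ...   | false | true  = j , at-away (t≢j ∘ sym) away
  ...   | false | false with 1≤games
  ...     | ()

  ¬home-and-away : {k : Slot n} {t j v : Team n} → T k t j ≡ true → T k v t ≡ true → ⊥
  ¬home-and-away {j = j} {v} h h′ with j ≟ v
  ... | yes refl = ¬host-and-guest h h′
  ... | no  j≢v  = j≢v (opponent-unique (host≢guest h) (host≢guest h′ ∘ sym) (games-host h) (games-guest h′))

  venue-unique : {k : Slot n} {t v v′ : Team n} → AtSlot T t k v → AtSlot T t k v′ → v ≡ v′
  venue-unique (inj₁ (refl , _))     (inj₁ (refl , _))     = refl
  venue-unique (inj₁ (refl , _ , h)) (inj₂ (_ , h′))       = ⊥-elim (¬home-and-away h h′)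
  venue-unique (inj₂ (_ , h))        (inj₁ (refl , _ , h′)) = ⊥-elim (¬home-and-away h′ h)
  venue-unique (inj₂ (v≢t , h))      (inj₂ (v′≢t , h′))     =
    opponent-unique (v≢t ∘ sym) (v′≢t ∘ sym) (games-guest h) (games-guest h′)

  position-unique : {p : ℕ} {t v v′ : Team n} → AtPos T t p v → AtPos T t p v′ → v ≡ v′
  position-unique (inj₁ (_ , refl))            (inj₁ (_ , refl))            = refl
  position-unique (inj₁ (refl , _))            (inj₂ (inj₁ (() , _)))
  position-unique (inj₁ (refl , _))            (inj₂ (inj₂ (_ , () , _)))
  position-unique (inj₂ (inj₁ (() , _)))       (inj₁ (refl , _))
  position-unique (inj₂ (inj₂ (_ , () , _)))   (inj₁ (refl , _))
  position-unique (inj₂ (inj₁ (_ , refl)))     (inj₂ (inj₁ (_ , refl)))     = refl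
  position-unique (inj₂ (inj₁ (refl , _)))     (inj₂ (inj₂ (k , e , _)))    = ⊥-elim (slot≢end {n} k (sym e))
  position-unique (inj₂ (inj₂ (k , refl , _))) (inj₂ (inj₁ (e , _)))        = ⊥-elim (slot≢end {n} k e)
  position-unique (inj₂ (inj₂ (k , refl , at))) (inj₂ (inj₂ (k′ , e , at′)))
    with FinP.toℕ-injective (ℕP.suc-injective e)
  ... | refl = venue-unique at at′

  departure-exists : {t i : Team n} → i ≢ t → Σ[ j ∈ Team n ] Travels T t i j
  departure-exists {t} {i} i≢t with match-exists i≢t
  ... | k , h with successor-or-last k
  ...   | inj₂ k+1≡S = t , last-travel k+1≡S (at-away i≢t h) i≢t
  ...   | inj₁ (k⁺ , k⁺≡k+1) with venue-exists k⁺ t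
  ...     | v , at = v , step-travel k⁺≡k+1 (at-away i≢t h) at i≢v
    where
      i≢v : i ≢ v
      i≢v refl = ℕP.1+n≢n (trans (sym k⁺≡k+1) (cong toℕ (match-slot-unique (away-match at i≢t) h)))

  arrival-exists : {t j : Team n} → j ≢ t → Σ[ i ∈ Team n ] Travels T t i j
  arrival-exists {t} {j} j≢t with match-exists j≢t
  ... | k , h with predecessor-or-first k
  ...   | inj₁ k≡0 = t , first-travel k≡0 (at-away j≢t h) (j≢t ∘ sym)
  ...   | inj₂ (k⁻ , k≡k⁻+1) with venue-exists k⁻ t
  ...     | v , at = v , step-travel k≡k⁻+1 at (at-away j≢t h) v≢j
    where
      v≢j : v ≢ j
      v≢j refl = ℕP.1+n≢n (trans (sym k≡k⁻+1) (cong toℕ (match-slot-unique h (away-match at j≢t))))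

  departure-unique : {t i j j′ : Team n} → i ≢ t → Travels T t i j → Travels T t i j′ → j ≡ j′
  departure-unique i≢t (_ , _ , at , next) (_ , _ , at′ , next′)
    with away-position at i≢t | away-position at′ i≢t
  ... | _ , refl , h | _ , refl , h′ with match-slot-unique h h′
  ...   | refl = position-unique next next′

  arrival-unique : {t i i′ j : Team n} → j ≢ t → Travels T t i j → Travels T t i′ j → i ≡ i′
  arrival-unique j≢t (_ , _ , prev , at) (_ , _ , prev′ , at′)
    with away-position at j≢t | away-position at′ j≢t
  ... | _ , p+1≡ , h | _ , p′+1≡ , h′ with match-slot-unique h h′
  ...   | refl with ℕP.suc-injective (trans p+1≡ (sym p′+1≡))
  ...     | refl = position-unique prev prev′

  homeGames : Slot n → Team n → ℕ
  homeGames k t = sum (except t (λ j → 𝟙 (T k t j)))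

  homeGames≤1 : {k : Slot n} {t : Team n} → homeGames k t ≤ 1
  homeGames≤1 {k} {t} = ℕP.≤-trans (sum-mono-≤ (except-mono-≤ t (λ j → ℕP.m≤m+n _ _))) (ℕP.≤-reflexive (plays k t))

  hosts : Slot n → Team n → Bool
  hosts k t = isYes (homeGames k t ℕP.≟ 1)

  home-sum≡hosts : (k : Slot n) (t : Team n) → sumExcept t (λ j → b2q (T k t j)) ≡ b2q (hosts k t)
  home-sum≡hosts k t = trans (sumExcept-b2q t (T k t)) 0-or-1
    where
      0-or-1 : fromℕ (homeGames k t) ≡ b2q (hosts k t)
      0-or-1 with homeGames k t | homeGames≤1 {k} {t}
      ... | 0 | _ = refl
      ... | 1 | _ = refl
      ... | suc (suc _) | s≤s ()

  hosts⇒at-home : {k : Slot n} {t : Team n} → hosts k t ≡ true → AtSlot T t k t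
  hosts⇒at-home {k} {t} hosts≡true with homeGames k t ℕP.≟ 1
  ... | yes games≡1 with sum-positive⇒term-positive (except t (λ j → 𝟙 (T k t j))) (ℕP.≤-reflexive (sym games≡1))
  ...   | j , 1≤ = at-home {j = j} (𝟙-positive _ (proj₂ (except-positive t (λ j → 𝟙 (T k t j)) 1≤)))
  hosts⇒at-home () | no _

  at-home⇒hosts : {k : Slot n} {t : Team n} → AtSlot T t k t → hosts k t ≡ true
  at-home⇒hosts (inj₂ (t≢t , _)) = ⊥-elim (t≢t refl)
  at-home⇒hosts {k} {t} (inj₁ (_ , j , h)) with homeGames k t ℕP.≟ 1
  ... | yes _        = refl
  ... | no  games≢1 = ⊥-elim (games≢1 (ℕP.≤-antisym homeGames≤1
                         (ℕP.≤-trans (𝟙-true h) (sum-except-≥-term t _ (host≢guest h)))))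

  module _ {Y : YBits n} (ψ : IsTravelVector T Y) where

    travels⇒Y : {t i j : Team n} → Travels T t i j → Y t i j ≡ true
    travels⇒Y {t} {i} {j} = Equivalence.from (ψ t i j)

    ψ-F2 : F2 (toPoint T Y)
    ψ-F2 k k′ k′≡k+1 i j t i≢j t≢i t≢j = b2q-and (T k i t) (T k′ j t) (Y t i j) (λ h h′ →
      travels⇒Y (step-travel k′≡k+1 (at-away (t≢i ∘ sym) h) (at-away (t≢j ∘ sym) h′) i≢j))

    ψ-F3 : F3 (toPoint T Y)
    ψ-F3 k k′ k′≡k+1 t j t≢j =
      subst (λ s → (s ℚ.+ b2q (T k′ j t)) ℚ.- 1ℚ ℚ.≤ b2q (Y t t j)) (sym (home-sum≡hosts k t))
        (b2q-and (hosts k t) (T k′ j t) (Y t t j) (λ h h′ →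
          travels⇒Y (step-travel k′≡k+1 (hosts⇒at-home h) (at-away (t≢j ∘ sym) h′) t≢j)))

    ψ-F4 : F4 (toPoint T Y)
    ψ-F4 k⁻ k k≡k⁻+1 i t i≢t =
      subst (λ s → (b2q (T k⁻ i t) ℚ.+ s) ℚ.- 1ℚ ℚ.≤ b2q (Y t i t)) (sym (home-sum≡hosts k t))
        (b2q-and (T k⁻ i t) (hosts k t) (Y t i t) (λ h h′ →
          travels⇒Y (step-travel k≡k⁻+1 (at-away i≢t h) (hosts⇒at-home h′) i≢t)))

    ψ-F5 : F5 (toPoint T Y)
    ψ-F5 k k≡0 t j t≢j = b2q-mono (T k j t) (Y t t j) (λ h →
      travels⇒Y (first-travel k≡0 (at-away (t≢j ∘ sym) h) t≢j))

    ψ-F6 : F6 (toPoint T Y)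
    ψ-F6 k k+1≡S i t i≢t = b2q-mono (T k i t) (Y t i t) (λ h →
      travels⇒Y (last-travel k+1≡S (at-away i≢t h) i≢t))

    ψ-faceEqs : FaceEqs (toPoint T Y)
    ψ-faceEqs = out , in′
      where
        out : ∀ i t → i ≢ t → sumExcept i (λ j → b2q (Y t i j)) ≡ 1ℚ
        out i t i≢t with departure-exists i≢t
        ... | j₀ , tr = sumExcept-b2q≡1 i (Y t i) (proj₁ tr) (travels⇒Y tr)
                          (λ j _ Ytij → departure-unique i≢t (Equivalence.to (ψ t i j) Ytij) tr)
        in′ : ∀ j t → j ≢ t → sumExcept j (λ i → b2q (Y t i j)) ≡ 1ℚ
        in′ j t j≢t with arrival-exists j≢t
        ... | i₀ , tr = sumExcept-b2q≡1 j (λ i → Y t i j) (proj₁ tr ∘ sym) (travels⇒Y tr)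
                          (λ i _ Ytij → arrival-unique j≢t (Equivalence.to (ψ t i j) Ytij) tr)

  module _ {Y : YBits n} where

    Dominates : Set
    Dominates = ∀ t i j → Travels T t i j → Y t i j ≡ true

    constraints⇒dominates : F2 (toPoint T Y) → F3 (toPoint T Y) → F4 (toPoint T Y) →
      F5 (toPoint T Y) → F6 (toPoint T Y) → Dominates
    constraints⇒dominates F2Y F3Y F4Y F5Y F6Y t i j tr with travel-cases tr
    ... | inj₁ (refl , k , k≡0 , at) =
      b2q-mono⁻¹ (Y t t j) (away-match at (proj₁ tr ∘ sym)) (F5Y k k≡0 t j (proj₁ tr))
    ... | inj₂ (inj₁ (refl , k , k+1≡S , at)) =
      b2q-mono⁻¹ (Y t i t) (away-match at (proj₁ tr)) (F6Y k k+1≡S i t (proj₁ tr))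
    ... | inj₂ (inj₂ (k , k′ , k′≡k+1 , at , at′)) = step at at′
      where
        step : AtSlot T t k i → AtSlot T t k′ j → Y t i j ≡ true
        step (inj₁ (refl , _)) (inj₁ (refl , _)) = ⊥-elim (proj₁ tr refl)
        step home@(inj₁ (refl , _)) (inj₂ (j≢t , h′)) = b2q-and⁻¹ (Y t t j) (at-home⇒hosts home) h′
          (subst (λ s → (s ℚ.+ b2q (T k′ j t)) ℚ.- 1ℚ ℚ.≤ b2q (Y t t j)) (home-sum≡hosts k t)
            (F3Y k k′ k′≡k+1 t j (j≢t ∘ sym)))
        step (inj₂ (i≢t , h)) home′@(inj₁ (refl , _)) = b2q-and⁻¹ (Y t i t) h (at-home⇒hosts home′)
          (subst (λ s → (b2q (T k i t) ℚ.+ s) ℚ.- 1ℚ ℚ.≤ b2q (Y t i t)) (home-sum≡hosts k′ t)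
            (F4Y k k′ k′≡k+1 i t i≢t))
        step (inj₂ (i≢t , h)) (inj₂ (j≢t , h′)) = b2q-and⁻¹ (Y t i j) h h′
          (F2Y k k′ k′≡k+1 i j t (proj₁ tr) (i≢t ∘ sym) (j≢t ∘ sym))

    dominates⇒outSum≥1 : Dominates → ∀ i t → i ≢ t → 1ℚ ℚ.≤ outSum t i (toPoint T Y)
    dominates⇒outSum≥1 dom i t i≢t with departure-exists i≢t
    ... | j , tr = sumExcept-b2q≥1 i (Y t i) (proj₁ tr) (dom t i j tr)

    dominates⇒inSum≥1 : Dominates → ∀ j t → j ≢ t → 1ℚ ℚ.≤ inSum t j (toPoint T Y)
    dominates⇒inSum≥1 dom j t j≢t with arrival-exists j≢t
    ... | i , tr = sumExcept-b2q≥1 j (λ i → Y t i j) (proj₁ tr ∘ sym) (dom t i j tr)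

    -- The face equations leave room for exactly one travel out of and into each foreign venue.
    dominates+faceEqs⇒ψ : NoDiagY Y → Dominates → FaceEqs (toPoint T Y) → IsTravelVector T Y
    dominates+faceEqs⇒ψ noDiagY dom (out , in′) t i j = mk⇔ Y⇒travels (dom t i j)
      where
        Y⇒travels : Y t i j ≡ true → Travels T t i j
        Y⇒travels Ytij with i ≟ j | i ≟ t
        ... | yes refl | _ with trans (sym Ytij) (noDiagY t i)
        ...   | ()
        Y⇒travels Ytij | no i≢j | no i≢t with departure-exists i≢t
        ...   | j′ , tr = subst (Travels T t i)
                  (sumExcept-b2q≡1⇒unique i (Y t i) (out i t i≢t) (proj₁ tr) i≢j (dom t i j′ tr) Ytij) tr
        Y⇒travels Ytij | no i≢j | yes refl with arrival-exists (i≢j ∘ sym)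
        ...   | i′ , tr = subst (λ v → Travels T t v j)
                  (sumExcept-b2q≡1⇒unique j (λ v → Y t v j) (in′ j t (i≢j ∘ sym))
                    (proj₁ tr ∘ sym) (i≢j ∘ sym) (dom t i′ j tr) Ytij) tr

module OfTournament {n : ℕ} (T : MatchSet n) (tour : Tournament T) =
  Schedule T (proj₁ tour) (proj₁ (tournament-structure T tour)) (proj₂ (tournament-structure T tour))

-- Generators and the face

module _ {n : ℕ} where

  travelGen⇒uttGen : (p : Point n) → TravelGen p → UttGen p
  travelGen⇒uttGen _ (T , Y , tour , ψ , refl) =
    T , Y , tour , (travel-vector-noDiag ψ , λ t i j → Equivalence.from (ψ t i j)) , refl

  travelGen⇒faceEqs : {p : Point n} → TravelGen p → FaceEqs p
  travelGen⇒faceEqs (T , Y , tour , ψ , refl) = OfTournament.ψ-faceEqs T tour ψ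

  uttGen⇒outSum≥1 : {p : Point n} → UttGen p → ∀ i t → i ≢ t → 1ℚ ℚ.≤ outSum t i p
  uttGen⇒outSum≥1 (T , Y , tour , (_ , dom) , refl) = OfTournament.dominates⇒outSum≥1 T tour dom

  uttGen⇒inSum≥1 : {p : Point n} → UttGen p → ∀ j t → j ≢ t → 1ℚ ℚ.≤ inSum t j p
  uttGen⇒inSum≥1 (T , Y , tour , (_ , dom) , refl) = OfTournament.dominates⇒inSum≥1 T tour dom

  uttGen+faceEqs⇒travelGen : {p : Point n} → UttGen p → FaceEqs p → TravelGen p
  uttGen+faceEqs⇒travelGen (T , Y , tour , (noDiagY , dom) , refl) face =
    T , Y , tour , OfTournament.dominates+faceEqs⇒ψ T tour noDiagY dom face , refl

  travelGen⇒ipFeasible : (p : Point n) → TravelGen p → IPFeasible p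
  travelGen⇒ipFeasible _ (T , Y , tour@(noDiag , F0T , F1T) , ψ , refl) =
    T , Y , noDiag , travel-vector-noDiag ψ , refl , F0T , F1T ,
    ψ-F2 ψ , ψ-F3 ψ , ψ-F4 ψ , ψ-F5 ψ , ψ-F6 ψ , ψ-faceEqs ψ
    where open OfTournament T tour

  ipFeasible⇒travelGen : (p : Point n) → IPFeasible p → TravelGen p
  ipFeasible⇒travelGen _ (X , Y , noDiag , noDiagY , refl , F0X , F1X , F2X , F3X , F4X , F5X , F6X , face) =
    X , Y , tour , dominates+faceEqs⇒ψ noDiagY (constraints⇒dominates F2X F3X F4X F5X F6X) face , refl
    where
      tour : Tournament X
      tour = noDiag , F0X , F1X
      open OfTournament X tour

  face⊆conv-ψ : (z : Point n) → FaceF z → conv TravelGen z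
  face⊆conv-ψ z ((L , gens , w , z≈x , z≈y) , out , in′) =
    conv-resp-≈ₚ (z≈x , z≈y) (conv-of-support L support w)
    where
      weights≥0 : All (λ lp → 0ℚ ℚ.≤ proj₁ lp) L
      weights≥0 = All.map proj₁ gens

      tight-out : ∀ i t → i ≢ t → All (λ lp → proj₁ lp ≢ 0ℚ → outSum t i (proj₂ lp) ≡ 1ℚ) L
      tight-out i t i≢t = weightedSum≡weights⇒tight L (outSum t i) weights≥0
        (All.map (λ (_ , u) → uttGen⇒outSum≥1 u i t i≢t) gens)
        (trans (sym (outSum-comb t i L))
          (trans (sumExcept-cong i (sym ∘ z≈y t i)) (trans (out i t i≢t) (sym w))))

      tight-in : ∀ j t → j ≢ t → All (λ lp → proj₁ lp ≢ 0ℚ → inSum t j (proj₂ lp) ≡ 1ℚ) L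
      tight-in j t j≢t = weightedSum≡weights⇒tight L (inSum t j) weights≥0
        (All.map (λ (_ , u) → uttGen⇒inSum≥1 u j t j≢t) gens)
        (trans (sym (inSum-comb t j L))
          (trans (sumExcept-cong j (λ i → sym (z≈y t i j))) (trans (in′ j t j≢t) (sym w))))

      support : All (λ lp → 0ℚ ℚ.≤ proj₁ lp × (proj₁ lp ≢ 0ℚ → TravelGen (proj₂ lp))) L
      support = All.tabulate λ lp∈L → proj₁ (All.lookup gens lp∈L) , λ l≢0 →
        uttGen+faceEqs⇒travelGen (proj₂ (All.lookup gens lp∈L))
          ( (λ i t i≢t → All.lookup (tight-out i t i≢t) lp∈L l≢0)
          , (λ j t j≢t → All.lookup (tight-in j t j≢t) lp∈L l≢0))

  conv-ψ⊆face : (z : Point n) → conv TravelGen z → FaceF z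
  conv-ψ⊆face z c@(L , gens , w , _ , z≈y) = conv-mono travelGen⇒uttGen z c , out , in′
    where
      out : ∀ i t → i ≢ t → outSum t i z ≡ 1ℚ
      out i t i≢t = trans (sumExcept-cong i (z≈y t i)) (trans (outSum-comb t i L)
        (trans (weightedSum-of-1 L (outSum t i) (All.map (λ (_ , g) → proj₁ (travelGen⇒faceEqs g) i t i≢t) gens)) w))

      in′ : ∀ j t → j ≢ t → inSum t j z ≡ 1ℚ
      in′ j t j≢t = trans (sumExcept-cong j (λ i → z≈y t i j)) (trans (inSum-comb t j L)
        (trans (weightedSum-of-1 L (inSum t j) (All.map (λ (_ , g) → proj₂ (travelGen⇒faceEqs g) j t j≢t) gens)) w))

theorem16 : (n : ℕ) → 4 ≤ n → Even n →
    (∀ (z : Point n) → FaceF z ⇔ conv TravelGen z)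
    × (∀ (z : Point n) → conv IPFeasible z ⇔ conv TravelGen z)
theorem16 n _ _ =
    (λ z → mk⇔ (face⊆conv-ψ z) (conv-ψ⊆face z))
  , (λ z → mk⇔ (conv-mono ipFeasible⇒travelGen z) (conv-mono travelGen⇒ipFeasible z))
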